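{- Let $G$ be a connected graph (multi-edges and loops allowed). Then $G$ is a minimal $(2,2)$-dominated graph if and only if $G$ has the following three properties: (1) $\delta(G)\ge 2$; (2) $G$ is bipartite; (3) every edge of $G$ is incident with a vertex of degree $2$ in $G$.
   Context: Graphs may have multiple edges and multiple loops. The degree $d_G(v)$ is the number of edges incident with $v$ plus twice the number of loops at $v$; $\delta(G)$ is the minimum degree. A set $D\subseteq V(G)$ is a $2$-dominating set of $G$ if every vertex of $V(G)\setminus D$ is joined by at least two edges (counted with multiplicity) to a vertex or vertices of $D$. A pair $(D_1,D_2)$ of proper, disjoint subsets of $V(G)$ is a $(2,2)$-pair if both $D_1$ and $D_2$ are $2$-dominating sets of $G$; $G$ is a $(2,2)$-dominated graph if it has a $(2,2)$-pair. A connected graph $G$ is a minimal $(2,2)$-dominated graph if $G$ is $(2,2)$-dominated and no proper spanning subgraph of $G$ (i.e., no graph obtained from $G$ by deleting at least one edge) is $(2,2)$-dominated. -}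

module Defs where

open import Data.Nat using (ℕ; zero; suc; _+_; _<_; _≤_)
open import Data.Bool using (Bool; true; false; if_then_else_)
open import Data.Fin using (Fin; _≟_)
open import Data.Fin.Subset using (Subset; _∈_; _∉_)
open import Data.Fin.Subset.Properties using (_∈?_)
open import Data.List using (List; []; _∷_; length)
open import Data.List.Relation.Binary.Sublist.Propositional using (_⊆_)
import Data.List.Membership.Propositional as Mem
open import Data.Product using (_×_; _,_; ∃; Σ)
open import Data.Sum using (_⊎_)
open import Relation.Nullary using (¬_; Dec; yes; no)
open import Relation.Nullary.Decidable using (⌊_⌋)
open import Relation.Binary.PropositionalEquality using (_≡_; _≢_)

-- A (finite) multigraph with loops on vertex set Fin n is given by its list of
-- edges; each edge is an (unordered) pair of endpoints, stored as an ordered pair.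
-- Repeated entries are parallel edges; an entry (v , v) is a loop at v.
Edges : ℕ → Set
Edges n = List (Fin n × Fin n)

[_] : ∀ {p} {P : Set p} → Dec P → ℕ
[ yes _ ] = 1
[ no _ ]  = 0

-- contribution of one edge to the degree of v (a loop at v contributes 2)
incid : ∀ {n} → Fin n → Fin n × Fin n → ℕ
incid v (a , b) = [ a ≟ v ] + [ b ≟ v ]

deg : ∀ {n} → Edges n → Fin n → ℕ
deg [] v = 0
deg (e ∷ E) v = incid v e + deg E v

-- number of edges joining v to a vertex of D, counted with multiplicity
-- (an edge (a , b) counts once for the end a = v with b ∈ D, and once for b = v with a ∈ D)
edgesToSet : ∀ {n} → Edges n → Fin n → Subset n → ℕ
edgesToSet [] v D = 0
edgesToSet ((a , b) ∷ E) v D =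
  (if ⌊ a ≟ v ⌋ then [ b ∈? D ] else 0) + (if ⌊ b ≟ v ⌋ then [ a ∈? D ] else 0)
  + edgesToSet E v D

TwoDominating : ∀ {n} → Edges n → Subset n → Set
TwoDominating E D = ∀ v → v ∉ D → 2 ≤ edgesToSet E v D

Proper : ∀ {n} → Subset n → Set
Proper {n} D = ∃ λ (v : Fin n) → v ∉ D

Disjoint : ∀ {n} → Subset n → Subset n → Set
Disjoint D₁ D₂ = ∀ v → ¬ (v ∈ D₁ × v ∈ D₂)

IsPair22 : ∀ {n} → Edges n → Subset n → Subset n → Set
IsPair22 E D₁ D₂ =
  Proper D₁ × Proper D₂ × Disjoint D₁ D₂ × TwoDominating E D₁ × TwoDominating E D₂

Dominated22 : ∀ {n} → Edges n → Set
Dominated22 {n} E = Σ (Subset n) λ D₁ → Σ (Subset n) λ D₂ → IsPair22 E D₁ D₂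

data Reach {n} (E : Edges n) : Fin n → Fin n → Set where
  here : ∀ {u} → Reach E u u
  fwd  : ∀ {a b c} → (a , b) Mem.∈ E → Reach E b c → Reach E a c
  bwd  : ∀ {a b c} → (a , b) Mem.∈ E → Reach E a c → Reach E b c

Connected : ∀ {n} → Edges n → Set
Connected {n} E = (0 < n) × (∀ u v → Reach E u v)

-- proper spanning subgraph: delete at least one edge (keep all vertices)
ProperSpanning : ∀ {n} → Edges n → Edges n → Set
ProperSpanning E' E = (E' ⊆ E) × (length E' < length E)

Minimal22 : ∀ {n} → Edges n → Set
Minimal22 E = Connected E × Dominated22 E × (∀ E' → ProperSpanning E' E → ¬ Dominated22 E')

MinDegreeAtLeast2 : ∀ {n} → Edges n → Set
MinDegreeAtLeast2 E = ∀ v → 2 ≤ deg E v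

Bipartite : ∀ {n} → Edges n → Set
Bipartite {n} E = ∃ λ (c : Fin n → Bool) → ∀ {a b} → (a , b) Mem.∈ E → c a ≢ c b

EveryEdgeMeetsDeg2 : ∀ {n} → Edges n → Set
EveryEdgeMeetsDeg2 E = ∀ {a b} → (a , b) Mem.∈ E → (deg E a ≡ 2) ⊎ (deg E b ≡ 2)

-- A (2,2)-pair (D₁ , D₂) can be replaced by (D₁ , ∁ D₁), since a superset of a
-- 2-dominating set is 2-dominating. An edge with both ends on the same side of D₁
-- counts for neither D₁ nor ∁ D₁, so in a minimal graph every edge crosses D₁ and
-- G is bipartite; and δ ≥ 2 because every vertex lies outside D₁ or outside D₂.
-- Conversely, if δ ≥ 2 and D is one side of a bipartition, all edges at a vertex
-- outside D go into D, so (D , ∁ D) is a (2,2)-pair. Deleting an edge whose ends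
-- both have degree ≥ 3 keeps δ ≥ 2 and the bipartition, hence domination; deleting
-- an edge at a vertex of degree 2 destroys δ ≥ 2, which domination requires.

module Submission where

open import Defs
open import Algebra.Properties.CommutativeSemigroup using (x∙yz≈y∙xz)
open import Data.Bool using (false; not; if_then_else_)
open import Data.Bool.Properties using (¬-not; not-injective)
open import Data.Empty using (⊥-elim)
open import Data.Fin using (Fin; _≟_; fromℕ<)
open import Data.Fin.Subset using (Subset; _∈_; _∉_; _⊆_; ∁; Nonempty)
open import Data.Fin.Subset.Properties
  using (_∈?_; nonempty?; x∈∁p⇒x∉p; x∈p⇒x∉∁p; x∉p⇒x∈∁p)
open import Data.List using (List; []; _∷_; length)
open import Data.List.Properties using (length-removeAt′)
open import Data.List.Membership.Propositional using (_─_) renaming (_∈_ to _∈ₗ_)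
open import Data.List.Relation.Binary.Sublist.Propositional
  using ([]; _∷_; _∷ʳ_; ⊆-refl) renaming (_⊆_ to _⊑_)
open import Data.List.Relation.Binary.Sublist.Propositional.Properties using (Any-resp-⊆)
open import Data.List.Relation.Unary.Any using (here; there; index)
open import Data.Nat using (ℕ; _+_; _≤_; _<_; z≤n; s≤s; s≤s⁻¹)
open import Data.Nat.Properties
  using (≤-trans; ≤-reflexive; +-mono-≤; +-monoʳ-≤; +-monoˡ-≤; ≤∧≢⇒<; +-commutativeSemigroup)
import Data.Nat.Properties as ℕ
open import Data.Product using (∃; ∃₂; _×_; _,_)
open import Data.Sum using (inj₁; inj₂; [_,_]′)
open import Data.Vec using (lookup; tabulate)
open import Data.Vec.Properties using (lookup⇒[]=; []=⇒lookup; lookup-map; lookup∘tabulate)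
open import Function using (_∘_)
open import Function.Bundles using (_⇔_; mk⇔)
open import Relation.Nullary using (yes; no; ¬_; contradiction)
open import Relation.Nullary.Decidable using (⌊_⌋)
open import Relation.Binary.PropositionalEquality
  using (_≡_; _≢_; refl; sym; trans; cong; cong₂; subst; subst₂; ≢-sym)

private
  variable
    A : Set
    n : ℕ
    x : A
    xs ys : List A
    a b v : Fin n
    D D′ : Subset n
    E : Edges n

x+[y+z]≡y+[x+z] : ∀ x y z → x + (y + z) ≡ y + (x + z)
x+[y+z]≡y+[x+z] = x∙yz≈y∙xz +-commutativeSemigroup

length-─ : (m : x ∈ₗ xs) → length (xs ─ m) < length xs
length-─ {xs = xs} m = ≤-reflexive (sym (length-removeAt′ xs (index m)))

─-⊑ : (m : x ∈ₗ xs) → xs ─ m ⊑ xs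
─-⊑ (here refl) = _ ∷ʳ ⊆-refl
─-⊑ (there m)   = refl ∷ ─-⊑ m

shorter-sublist⇒⊑─ : xs ⊑ ys → length xs < length ys →
                     ∃₂ λ y (m : y ∈ₗ ys) → xs ⊑ ys ─ m
shorter-sublist⇒⊑─ (y ∷ʳ xs⊑ys) _ = y , here refl , xs⊑ys
shorter-sublist⇒⊑─ (refl ∷ xs⊑ys) (s≤s shorter) =
  let y , m , xs⊑ys─m = shorter-sublist⇒⊑─ xs⊑ys shorter
  in  y , there m , refl ∷ xs⊑ys─m

∉⇒lookup≡false : a ∉ D → lookup D a ≡ false
∉⇒lookup≡false {a = a} {D = D} a∉D = ¬-not (a∉D ∘ lookup⇒[]= a D)

lookup≢⇒∈ : lookup D a ≢ lookup D b → a ∉ D → b ∈ D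
lookup≢⇒∈ {D = D} {b = b} neq a∉D =
  lookup⇒[]= b D (¬-not (≢-sym (subst (_≢ lookup D b) (∉⇒lookup≡false a∉D) neq)))

lookup≡⇒∉ : lookup D a ≡ lookup D b → a ∉ D → b ∉ D
lookup≡⇒∉ eq a∉D b∈D = a∉D (lookup⇒[]= _ _ (trans eq ([]=⇒lookup b∈D)))

lookup-∁ : ∀ (D : Subset n) a → lookup (∁ D) a ≡ not (lookup D a)
lookup-∁ D a = lookup-map a not D

-- With these, edgesToSet (e ∷ E) v D reduces to edgeToSet v D e + edgesToSet E v D.
halfEdge : Fin n → Subset n → Fin n → Fin n → ℕ
halfEdge v D a b = if ⌊ a ≟ v ⌋ then [ b ∈? D ] else 0

edgeToSet : Fin n → Subset n → Fin n × Fin n → ℕ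
edgeToSet v D (a , b) = halfEdge v D a b + halfEdge v D b a

halfEdge≤[≟] : ∀ v D (a b : Fin n) → halfEdge v D a b ≤ [ a ≟ v ]
halfEdge≤[≟] v D a b with a ≟ v | b ∈? D
... | yes _ | yes _ = s≤s z≤n
... | yes _ | no _  = z≤n
... | no _  | _     = z≤n

[≟]≤halfEdge : ∀ v D (a b : Fin n) → (a ≡ v → b ∈ D) → [ a ≟ v ] ≤ halfEdge v D a b
[≟]≤halfEdge v D a b b∈D with a ≟ v
... | no _     = z≤n
... | yes a≡v with b ∈? D
...   | yes _   = s≤s z≤n
...   | no b∉D  = contradiction (b∈D a≡v) b∉D

halfEdge-mono : D ⊆ D′ → ∀ v (a b : Fin n) → halfEdge v D a b ≤ halfEdge v D′ a b
halfEdge-mono {D = D} {D′ = D′} D⊆D′ v a b with a ≟ v | b ∈? D | b ∈? D′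
... | no _  | _      | _       = z≤n
... | yes _ | no _   | _       = z≤n
... | yes _ | yes _  | yes _   = s≤s z≤n
... | yes _ | yes b∈ | no b∉D′ = contradiction (D⊆D′ b∈) b∉D′

halfEdge≡0 : ∀ v D (a b : Fin n) → (a ≡ v → b ∉ D) → halfEdge v D a b ≡ 0
halfEdge≡0 v D a b b∉D with a ≟ v
... | no _ = refl
... | yes a≡v with b ∈? D
...   | yes b∈D = contradiction b∈D (b∉D a≡v)
...   | no _    = refl

edgeToSet≤incid : ∀ v D (e : Fin n × Fin n) → edgeToSet v D e ≤ incid v e
edgeToSet≤incid v D (a , b) = +-mono-≤ (halfEdge≤[≟] v D a b) (halfEdge≤[≟] v D b a)

incid≤edgeToSet : v ∉ D → lookup D a ≢ lookup D b → incid v (a , b) ≤ edgeToSet v D (a , b)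
incid≤edgeToSet {v = v} {D = D} {a = a} {b = b} v∉D neq =
  +-mono-≤ ([≟]≤halfEdge v D a b λ { refl → lookup≢⇒∈ neq v∉D })
           ([≟]≤halfEdge v D b a λ { refl → lookup≢⇒∈ (≢-sym neq) v∉D })

edgeToSet≡0 : v ∉ D → lookup D a ≡ lookup D b → edgeToSet v D (a , b) ≡ 0
edgeToSet≡0 {v = v} {D = D} {a = a} {b = b} v∉D eq =
  cong₂ _+_ (halfEdge≡0 v D a b λ { refl → lookup≡⇒∉ eq v∉D })
            (halfEdge≡0 v D b a λ { refl → lookup≡⇒∉ (sym eq) v∉D })

edgesToSet≤deg : ∀ (E : Edges n) v D → edgesToSet E v D ≤ deg E v
edgesToSet≤deg []      v D = z≤n
edgesToSet≤deg (e ∷ E) v D = +-mono-≤ (edgeToSet≤incid v D e) (edgesToSet≤deg E v D)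

edgesToSet-mono : D ⊆ D′ → ∀ (E : Edges n) v → edgesToSet E v D ≤ edgesToSet E v D′
edgesToSet-mono D⊆D′ []            v = z≤n
edgesToSet-mono D⊆D′ ((a , b) ∷ E) v =
  +-mono-≤ (+-mono-≤ (halfEdge-mono D⊆D′ v a b) (halfEdge-mono D⊆D′ v b a))
           (edgesToSet-mono D⊆D′ E v)

edgesToSet-empty : ¬ Nonempty D → ∀ (E : Edges n) v → edgesToSet E v D ≡ 0
edgesToSet-empty empty []            v = refl
edgesToSet-empty empty ((a , b) ∷ E) v =
  cong₂ _+_ (cong₂ _+_ (halfEdge≡0 v _ a b λ _ b∈D → empty (b , b∈D))
                       (halfEdge≡0 v _ b a λ _ a∈D → empty (a , a∈D)))
            (edgesToSet-empty empty E v)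

deg-─ : (m : x ∈ₗ E) → ∀ v → deg E v ≡ incid v x + deg (E ─ m) v
deg-─ (here refl) v = refl
deg-─ {x = x} {E = y ∷ E} (there m) v =
  trans (cong (incid v y +_) (deg-─ m v)) (x+[y+z]≡y+[x+z] (incid v y) (incid v x) _)

edgesToSet-─ : (m : x ∈ₗ E) → ∀ v D →
               edgesToSet E v D ≡ edgeToSet v D x + edgesToSet (E ─ m) v D
edgesToSet-─ (here refl) v D = refl
edgesToSet-─ {x = x} {E = y ∷ E} (there m) v D =
  trans (cong (edgeToSet v D y +_) (edgesToSet-─ m v D))
        (x+[y+z]≡y+[x+z] (edgeToSet v D y) (edgeToSet v D x) _)

deg-mono : ∀ {E′ E : Edges n} → E′ ⊑ E → ∀ v → deg E′ v ≤ deg E v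
deg-mono []                       v = z≤n
deg-mono (y ∷ʳ E′⊑E)              v = ≤-trans (deg-mono E′⊑E v) (ℕ.m≤n+m _ (incid v y))
deg-mono (_∷_ {x = y} refl E′⊑E) v = +-monoʳ-≤ (incid v y) (deg-mono E′⊑E v)

incid-fst : ∀ (a b : Fin n) → 1 ≤ incid a (a , b)
incid-fst a b with a ≟ a
... | yes _  = s≤s z≤n
... | no a≢a = contradiction refl a≢a

incid-snd : ∀ (a b : Fin n) → 1 ≤ incid b (a , b)
incid-snd a b with b ≟ b
... | yes _  = ℕ.m≤n+m 1 [ a ≟ b ]
... | no b≢b = contradiction refl b≢b

deg-⊑─ : ∀ {E′} (m : x ∈ₗ E) → E′ ⊑ E ─ m → ∀ v → deg E′ v + incid v x ≤ deg E v
deg-⊑─ {x = x} {E = E} {E′ = E′} m E′⊑E─m v = begin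
  deg E′ v + incid v x        ≤⟨ +-monoˡ-≤ (incid v x) (deg-mono E′⊑E─m v) ⟩
  deg (E ─ m) v + incid v x   ≡⟨ ℕ.+-comm (deg (E ─ m) v) (incid v x) ⟩
  incid v x + deg (E ─ m) v   ≡⟨ sym (deg-─ m v) ⟩
  deg E v                     ∎
  where open ℕ.≤-Reasoning

IsBipartition : Subset n → Edges n → Set
IsBipartition D E = ∀ {a b} → (a , b) ∈ₗ E → lookup D a ≢ lookup D b

bipartite⇒bipartition : Bipartite E → ∃ λ D → IsBipartition D E
bipartite⇒bipartition (c , proper) =
  tabulate c ,
  λ {a} {b} m → subst₂ _≢_ (sym (lookup∘tabulate c a)) (sym (lookup∘tabulate c b)) (proper m)

lookup∁-cong : ∀ (D : Subset n) → lookup D a ≡ lookup D b → lookup (∁ D) a ≡ lookup (∁ D) b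
lookup∁-cong {a = a} {b = b} D eq =
  trans (lookup-∁ D a) (trans (cong not eq) (sym (lookup-∁ D b)))

bipartition-∁ : IsBipartition D E → IsBipartition (∁ D) E
bipartition-∁ {D = D} split {a} {b} m eq =
  split m (not-injective (trans (sym (lookup-∁ D a)) (trans eq (lookup-∁ D b))))

bipartition-⊑ : ∀ {E′} → E′ ⊑ E → IsBipartition D E → IsBipartition D E′
bipartition-⊑ E′⊑E split = split ∘ Any-resp-⊆ E′⊑E

deg≤edgesToSet : ∀ (E : Edges n) → IsBipartition D E → v ∉ D → deg E v ≤ edgesToSet E v D
deg≤edgesToSet []      split v∉D = z≤n
deg≤edgesToSet (_ ∷ E) split v∉D =
  +-mono-≤ (incid≤edgeToSet v∉D (split (here refl))) (deg≤edgesToSet E (split ∘ there) v∉D)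

twoDominating-mono : D ⊆ D′ → TwoDominating E D → TwoDominating E D′
twoDominating-mono {E = E} D⊆D′ dom v v∉D′ =
  ≤-trans (dom v (v∉D′ ∘ D⊆D′)) (edgesToSet-mono D⊆D′ E v)

twoDominating-─ : (m : (a , b) ∈ₗ E) → lookup D a ≡ lookup D b →
                  TwoDominating E D → TwoDominating (E ─ m) D
twoDominating-─ {E = E} {D = D} m eq dom v v∉D =
  subst (2 ≤_) (trans (edgesToSet-─ m v D) (cong (_+ edgesToSet (E ─ m) v D) (edgeToSet≡0 v∉D eq)))
        (dom v v∉D)

twoDominating⇒nonempty : {E : Edges n} {D : Subset n} → Fin n → TwoDominating E D → Nonempty D
twoDominating⇒nonempty {E = E} {D = D} v dom with v ∈? D | nonempty? D
... | yes v∈D | _             = v , v∈D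
... | no _    | yes nonempty  = nonempty
... | no v∉D  | no empty      =
  contradiction (subst (2 ≤_) (edgesToSet-empty empty E v) (dom v v∉D)) λ ()

nonempty⇒proper∁ : Nonempty D → Proper (∁ D)
nonempty⇒proper∁ (v , v∈D) = v , x∈p⇒x∉∁p v∈D

nonempty∁⇒proper : Nonempty (∁ D) → Proper D
nonempty∁⇒proper (v , v∈∁D) = v , x∈∁p⇒x∉p v∈∁D

complementaryPair : {E : Edges n} {D : Subset n} → Fin n →
                    TwoDominating E D → TwoDominating E (∁ D) → Dominated22 E
complementaryPair {E = E} {D = D} v dom dom∁ =
  D , ∁ D , nonempty∁⇒proper (twoDominating⇒nonempty {E = E} v dom∁) ,
  nonempty⇒proper∁ (twoDominating⇒nonempty {E = E} v dom) ,
  (λ w (w∈D , w∈∁D) → x∈∁p⇒x∉p w∈∁D w∈D) , dom , dom∁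

dominated⇒minDegree : Dominated22 E → MinDegreeAtLeast2 E
dominated⇒minDegree {E = E} (D₁ , D₂ , _ , _ , disjoint , dom₁ , dom₂) v with v ∈? D₁
... | yes v∈D₁ = ≤-trans (dom₂ v λ v∈D₂ → disjoint v (v∈D₁ , v∈D₂)) (edgesToSet≤deg E v D₂)
... | no v∉D₁  = ≤-trans (dom₁ v v∉D₁) (edgesToSet≤deg E v D₁)

bipartition⇒twoDominating : MinDegreeAtLeast2 E → IsBipartition D E → TwoDominating E D
bipartition⇒twoDominating {E = E} δ split v v∉D = ≤-trans (δ v) (deg≤edgesToSet E split v∉D)

bipartition⇒dominated : {E : Edges n} (D : Subset n) → Fin n →
                        MinDegreeAtLeast2 E → IsBipartition D E → Dominated22 E
bipartition⇒dominated {E = E} D v δ split =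
  complementaryPair {E = E} v (bipartition⇒twoDominating δ split)
                             (bipartition⇒twoDominating {D = ∁ D} δ (bipartition-∁ {D = D} split))

deleteEdge : (m : x ∈ₗ E) → ProperSpanning (E ─ m) E
deleteEdge m = ─-⊑ m , length-─ m

NoDominatedProperSpanning : Edges n → Set
NoDominatedProperSpanning E = ∀ E′ → ProperSpanning E′ E → ¬ Dominated22 E′

minimal⇒bipartition : NoDominatedProperSpanning E →
                      ∀ {D₁ D₂} → IsPair22 E D₁ D₂ → IsBipartition D₁ E
minimal⇒bipartition {E = E} minimal {D₁} (_ , _ , disjoint , dom₁ , dom₂) {a} m eq =
  minimal (E ─ m) (deleteEdge m)
    (complementaryPair {E = E ─ m} a (twoDominating-─ {D = D₁} m eq dom₁)
                                     (twoDominating-─ {D = ∁ D₁} m (lookup∁-cong D₁ eq) dom∁₁))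
  where
  dom∁₁ : TwoDominating E (∁ D₁)
  dom∁₁ = twoDominating-mono {E = E} (λ x∈D₂ → x∉p⇒x∈∁p λ x∈D₁ → disjoint _ (x∈D₁ , x∈D₂))
                               dom₂

minDegree-─ : MinDegreeAtLeast2 E → (m : (a , b) ∈ₗ E) → a ≢ b →
              3 ≤ deg E a → 3 ≤ deg E b → MinDegreeAtLeast2 (E ─ m)
minDegree-─ {a = a} {b = b} δ m a≢b 3≤deg-a 3≤deg-b v with a ≟ v | b ≟ v | deg-─ m v
... | yes refl | yes refl | _    = contradiction refl a≢b
... | yes refl | no _     | deg≡ = s≤s⁻¹ (subst (3 ≤_) deg≡ 3≤deg-a)
... | no _     | yes refl | deg≡ = s≤s⁻¹ (subst (3 ≤_) deg≡ 3≤deg-b)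
... | no _     | no _     | deg≡ = subst (2 ≤_) deg≡ (δ v)

minDegree-⊑─⇒3≤deg : ∀ {E′} → MinDegreeAtLeast2 E′ → (m : x ∈ₗ E) → E′ ⊑ E ─ m →
                     1 ≤ incid v x → 3 ≤ deg E v
minDegree-⊑─⇒3≤deg {v = v} δ′ m E′⊑E─m 1≤incid =
  ≤-trans (+-mono-≤ (δ′ v) 1≤incid) (deg-⊑─ m E′⊑E─m v)

meetsDeg2⇒minimal : EveryEdgeMeetsDeg2 E → NoDominatedProperSpanning E
meetsDeg2⇒minimal {E = E} meetsDeg2 E′ (E′⊑E , shorter) dominated′
  with shorter-sublist⇒⊑─ E′⊑E shorter
... | (a , b) , m , E′⊑E─m =
  [ ℕ.>⇒≢ (3≤deg (incid-fst a b)) , ℕ.>⇒≢ (3≤deg (incid-snd a b)) ]′ (meetsDeg2 m)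
  where
  3≤deg : ∀ {v} → 1 ≤ incid v (a , b) → 3 ≤ deg E v
  3≤deg = minDegree-⊑─⇒3≤deg (dominated⇒minDegree {E = E′} dominated′) m E′⊑E─m

minimal⇒meetsDeg2 : MinDegreeAtLeast2 E → NoDominatedProperSpanning E →
                    IsBipartition D E → EveryEdgeMeetsDeg2 E
minimal⇒meetsDeg2 {E = E} {D = D} δ minimal split {a} {b} m
  with deg E a ℕ.≟ 2 | deg E b ℕ.≟ 2
... | yes deg-a≡2 | _           = inj₁ deg-a≡2
... | no _        | yes deg-b≡2 = inj₂ deg-b≡2
... | no deg-a≢2  | no deg-b≢2  =
  ⊥-elim (minimal (E ─ m) (deleteEdge m) (bipartition⇒dominated D a δ′ split′))
  where
  δ′ : MinDegreeAtLeast2 (E ─ m)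
  δ′ = minDegree-─ δ m (split m ∘ cong (lookup D))
                   (≤∧≢⇒< (δ a) (deg-a≢2 ∘ sym)) (≤∧≢⇒< (δ b) (deg-b≢2 ∘ sym))
  split′ : IsBipartition D (E ─ m)
  split′ = bipartition-⊑ {D = D} (─-⊑ m) split

minimal22⇒properties : Minimal22 E → MinDegreeAtLeast2 E × Bipartite E × EveryEdgeMeetsDeg2 E
minimal22⇒properties {E = E} (_ , dominated@(D₁ , _ , pair) , minimal) =
  δ , (lookup D₁ , split) , minimal⇒meetsDeg2 {D = D₁} δ minimal split
  where
  δ : MinDegreeAtLeast2 E
  δ = dominated⇒minDegree {E = E} dominated
  split : IsBipartition D₁ E
  split = minimal⇒bipartition minimal pair

properties⇒minimal22 : Connected E →
                       MinDegreeAtLeast2 E × Bipartite E × EveryEdgeMeetsDeg2 E → Minimal22 E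
properties⇒minimal22 connected@(0<n , _) (δ , bipartite , meetsDeg2)
  with bipartite⇒bipartition bipartite
... | D , split =
  connected , bipartition⇒dominated D (fromℕ< 0<n) δ split , meetsDeg2⇒minimal meetsDeg2

theorem2p5 : ∀ {n : ℕ} (E : Edges n) → Connected E →
    (Minimal22 E ⇔ (MinDegreeAtLeast2 E × Bipartite E × EveryEdgeMeetsDeg2 E))
theorem2p5 E connected = mk⇔ minimal22⇒properties (properties⇒minimal22 connected)
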